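{- Fix $J\in D$ and $\alpha<\omega_1$. Suppose $A\subset\omega$ is such that $A\cap Z_{I,J,\alpha}$ is finite for every $I\in D$. Then there is $i\in\omega$ such that $f_{J,\alpha}(x)<i$ for all $x\in A$.
   Context: An interval partition is $I=\langle i_n:n\in\omega\rangle$ with $i_0=0$, $i_n<i_{n+1}$, $I_n=[i_n,i_{n+1})$. $D$ is a family of interval partitions with $|D|\le\mathfrak{d}$ such that for each $J\in D$ and $k\in\omega$ there is $l_{J,k}\in\omega$ with $l_{J,k}>0$, $l_{J,k}\ge k$ and $|J_k|=2^{l_{J,k}}$, and such that for every interval partition $K$ there is $I\in D$ with: for all but finitely many $n$ there is $k>n$ with $K_k\subset I_n$. For each $J\in D$ fix sets $A_{J,k,\sigma}\subset J_k$ ($k\in\omega$, $\sigma\in 2^{\le l_{J,k}}$) such that for each $k$: for every $m\le l_{J,k}$, $\{A_{J,k,\sigma}:\sigma\in 2^m\}$ partitions $J_k$ into disjoint sets; $|A_{J,k,\sigma}|=2^{l_{J,k}-|\sigma|}$ and $A_{J,k,\tau}\subset A_{J,k,\sigma}$ when $\sigma\subset\tau$; distinct elements $i,j$ of $A_{J,k,\sigma}$ satisfy $|i-j|>2^{|\sigma|-1}$. Let $\mathcal{F}_J$ be the set of $f\in\omega^\omega$ such that for each $k$ and each $l<l_{J,k}$ there is $\sigma\in 2^{l+1}$ with $f^{ -1}(\{l\})\cap J_k=A_{J,k,\sigma}$, and there is $\tau\in 2^{l_{J,k}}$ with $f^{ -1}(\{l_{J,k}\})\cap J_k=A_{J,k,\tau}$;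 for $f\in\mathcal{F}_J$ and $l\le l_{J,k}$ let $\sigma_{f,k,l}\in 2^l$ be the unique $\sigma$ with $A_{J,k,\sigma}=\{x\in J_k:f(x)\ge l\}$. Fix $\langle f_{J,\alpha}:\alpha<\omega_1\rangle$ with each $f_{J,\alpha}\in\mathcal{F}_J$ and such that for all $i,m\in\omega$ with $m\le 2^i$ and every $m$-element $F\subset\omega_1$ there is an infinite $B\subset\omega\setminus i$ such that $\sigma_{f_{J,\alpha},k,i}\ne\sigma_{f_{J,\beta},k,i}$ for all distinct $\alpha,\beta\in F$ and all $k\in B$. For $\langle I,J,\alpha,l\rangle\in D\times D\times\omega_1\times\omega$ let $Z_{I,J,\alpha,l}=\bigcup_{k\in I_l}\{x\in J_k: f_{J,\alpha}(x)\ge l\}$, and $Z_{I,J,\alpha}=\bigcup_{l\in\omega}Z_{I,J,\alpha,l}$. -}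

module Defs where

open import Level using (0ℓ)
open import Data.Nat using (ℕ; zero; suc; _+_; _*_; _∸_; _^_; _≤_; _<_; ∣_-_∣)
open import Data.Bool using (Bool; true; false; if_then_else_)
open import Data.List using (List; length; _++_)
open import Data.Fin using (Fin)
open import Data.Product using (Σ; _×_; _,_)
open import Relation.Binary.PropositionalEquality using (_≡_; _≢_)
open import Function.Definitions using (Injective)

record IntervalPartition : Set where
  field
    pt   : ℕ → ℕ
    pt0  : pt 0 ≡ 0
    incr : ∀ n → pt n < pt (suc n)
open IntervalPartition public

InBlock : ℕ → IntervalPartition → ℕ → Set
InBlock x I n = pt I n ≤ x × x < pt I (suc n)

blockSize : IntervalPartition → ℕ → ℕ
blockSize I n = pt I (suc n) ∸ pt I n

BlockSub : IntervalPartition → ℕ → IntervalPartition → ℕ → Set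
BlockSub K k I n = pt I n ≤ pt K k × pt K (suc k) ≤ pt I (suc n)

Catches : IntervalPartition → IntervalPartition → Set
Catches I K = Σ ℕ λ N → ∀ n → N ≤ n → Σ ℕ λ k → n < k × BlockSub K k I n

count : (ℕ → Bool) → ℕ → ℕ → ℕ
count p a zero = 0
count p a (suc len) = (if p a then 1 else 0) + count p (suc a) len

Prefix : List Bool → List Bool → Set
Prefix σ τ = Σ (List Bool) λ ρ → σ ++ ρ ≡ τ

_↔_ : Set → Set → Set
P ↔ Q = (P → Q) × (Q → P)

-- Conditions on the sets A_{J,k,σ} (σ ∈ 2^{≤ l_{J,k}}), given as decidable
-- subsets  A k σ : ℕ → Bool  of ω.
record ATree (J : IntervalPartition) (l : ℕ → ℕ)
             (A : ℕ → List Bool → ℕ → Bool) : Set where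
  field
    A-sub     : ∀ k σ → length σ ≤ l k → ∀ x → A k σ x ≡ true → InBlock x J k
    A-cover   : ∀ k m → m ≤ l k → ∀ x → InBlock x J k →
                Σ (List Bool) λ σ → length σ ≡ m × A k σ x ≡ true
    A-disj    : ∀ k σ τ → length σ ≡ length τ → length σ ≤ l k → ∀ x →
                A k σ x ≡ true → A k τ x ≡ true → σ ≡ τ
    A-size    : ∀ k σ → length σ ≤ l k →
                count (A k σ) (pt J k) (blockSize J k) ≡ 2 ^ (l k ∸ length σ)
    A-nested  : ∀ k σ τ → length τ ≤ l k → Prefix σ τ → ∀ x →
                A k τ x ≡ true → A k σ x ≡ true
    -- |i - j| > 2^{|σ|-1}, written as 2^{|σ|} < 2 |i - j|
    A-spread  : ∀ k σ → length σ ≤ l k → ∀ i j → A k σ i ≡ true → A k σ j ≡ true →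
                i ≢ j → 2 ^ length σ < 2 * ∣ i - j ∣

InF : IntervalPartition → (ℕ → ℕ) → (ℕ → List Bool → ℕ → Bool) → (ℕ → ℕ) → Set
InF J l A f = ∀ k →
  (∀ m → m < l k → Σ (List Bool) λ σ → length σ ≡ suc m ×
     (∀ x → InBlock x J k → (f x ≡ m) ↔ (A k σ x ≡ true)))
  × (Σ (List Bool) λ τ → length τ ≡ l k ×
     (∀ x → InBlock x J k → (f x ≡ l k) ↔ (A k τ x ≡ true)))

IsSigma : IntervalPartition → (ℕ → List Bool → ℕ → Bool) → (ℕ → ℕ) →
          ℕ → ℕ → List Bool → Set
IsSigma J A f k m σ = length σ ≡ m × (∀ x → InBlock x J k → (A k σ x ≡ true) ↔ (m ≤ f x))

-- The independence property of ⟨ f_α : α ∈ Ω ⟩ (Ω plays the role of ω₁).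
Independent : (Ω : Set) → IntervalPartition → (ℕ → List Bool → ℕ → Bool) →
              (Ω → ℕ → ℕ) → Set₁
Independent Ω J A f =
  ∀ i m → m ≤ 2 ^ i → (F : Fin m → Ω) → Injective _≡_ _≡_ F →
  Σ (ℕ → Set) λ B →
    (∀ k → B k → i ≤ k) ×
    (∀ n → Σ ℕ λ k → n ≤ k × B k) ×
    (∀ a b → a ≢ b → ∀ k → B k → ∀ σ τ →
       IsSigma J A (f (F a)) k i σ → IsSigma J A (f (F b)) k i τ → σ ≢ τ)

-- The standing setup: the family D (indexed by a type D), l_{J,k}, A_{J,k,σ},
-- and the functions f_{J,α}.
record Setup : Set₁ where
  field
    Ω          : Set
    D          : Set
    part       : D → IntervalPartition
    dominating : ∀ (K : IntervalPartition) → Σ D λ I → Catches (part I) K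
    l          : D → ℕ → ℕ
    l-pos      : ∀ J k → 0 < l J k
    l-ge       : ∀ J k → k ≤ l J k
    l-size     : ∀ J k → blockSize (part J) k ≡ 2 ^ l J k
    A          : D → ℕ → List Bool → ℕ → Bool
    A-tree     : ∀ J → ATree (part J) (l J) (A J)
    f          : D → Ω → ℕ → ℕ
    f-in       : ∀ J α → InF (part J) (l J) (A J) (f J α)
    indep      : ∀ J → Independent Ω (part J) (A J) (f J)
open Setup public

InZ : (S : Setup) → D S → D S → Ω S → ℕ → Set
InZ S I J α x = Σ ℕ λ n → Σ ℕ λ k →
  InBlock k (part S I) n × InBlock x (part S J) k × n ≤ f S J α x

Finite : (ℕ → Set) → Set
Finite P = Σ ℕ λ N → ∀ x → P x → x < N

-- If f = f_{J,α} were unbounded on A, excluded middle would give points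
-- x_j ∈ A with f(x_j) ≥ j, each lying beyond the J-block of the previous one.
-- Grouping the J-blocks into a partition K whose j-th block contains the
-- J-block of x_j, a dominating I ∈ D has, for almost every n, some j > n with
-- K_j ⊂ I_n; then x_j ∈ Z_{I,J,α,n} and x_j ≥ n, so A ∩ Z_{I,J,α} is infinite.
module Submission where

open import Defs
open import Level using (0ℓ)
open import Axiom.ExcludedMiddle using (ExcludedMiddle)
open import Data.Nat using (ℕ; zero; suc; _+_; _⊔_; _≤_; _<_; _≤?_; z≤n; s≤s)
open import Data.Nat.Properties
open import Data.Product using (Σ; _×_; _,_; proj₁; proj₂)
open import Data.Sum using (inj₁; inj₂)
open import Data.Empty using (⊥-elim)
open import Relation.Nullary using (¬_; yes; no)
open import Relation.Binary.PropositionalEquality using (refl; sym; subst)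

pt-mono : (P : IntervalPartition) → ∀ {m n} → m ≤ n → pt P m ≤ pt P n
pt-mono P {n = zero} z≤n = ≤-refl
pt-mono P {m} {suc n} m≤1+n with m≤n⇒m<n∨m≡n m≤1+n
... | inj₁ m<1+n = ≤-trans (pt-mono P (≤-pred m<1+n)) (<⇒≤ (incr P n))
... | inj₂ refl  = ≤-refl

n≤pt : (P : IntervalPartition) → ∀ n → n ≤ pt P n
n≤pt P zero    = z≤n
n≤pt P (suc n) = ≤-trans (s≤s (n≤pt P n)) (incr P n)

block-of : (P : IntervalPartition) → ∀ x → Σ ℕ (InBlock x P)
block-of P zero =
  0 , subst (_≤ 0) (sym (pt0 P)) z≤n , subst (_< pt P 1) (pt0 P) (incr P 0)
block-of P (suc x) with block-of P x
... | n , pn≤x , x<pn+1 with m≤n⇒m<n∨m≡n x<pn+1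
...   | inj₁ x+1<pn+1 = n , m≤n⇒m≤1+n pn≤x , x+1<pn+1
...   | inj₂ x+1≡pn+1 =
  suc n , ≤-reflexive (sym x+1≡pn+1) , subst (_< pt P (suc (suc n))) (sym x+1≡pn+1) (incr P (suc n))

InBlock⇒≤ : (P : IntervalPartition) → ∀ {x n} → InBlock x P n → n ≤ x
InBlock⇒≤ P {n = n} (pn≤x , _) = ≤-trans (n≤pt P n) pn≤x

pt≤⇒≤-block : (P : IntervalPartition) → ∀ {p x k} →
  pt P p ≤ x → InBlock x P k → p ≤ k
pt≤⇒≤-block P {p} {k = k} pp≤x (_ , x<pk+1) with p ≤? k
... | yes p≤k = p≤k
... | no  p≰k =
  ⊥-elim (<⇒≱ (≤-<-trans pp≤x x<pk+1) (pt-mono P (≰⇒> p≰k)))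

InBlock-BlockSub : ∀ K I {k j n} → BlockSub K j I n → InBlock k K j → InBlock k I n
InBlock-BlockSub _ _ (pn≤kj , kj+1≤pn+1) (kj≤k , k<kj+1) =
  ≤-trans pn≤kj kj≤k , <-≤-trans k<kj+1 kj+1≤pn+1

bounded-on-initial-segment : (g : ℕ → ℕ) → ∀ b → Σ ℕ λ c → ∀ x → x < b → g x < c
bounded-on-initial-segment g zero = 0 , λ _ ()
bounded-on-initial-segment g (suc b) with bounded-on-initial-segment g b
... | c , below = suc (g b) ⊔ c , bound
  where
  bound : ∀ x → x < suc b → g x < suc (g b) ⊔ c
  bound x x<b+1 with m<1+n⇒m<n∨m≡n x<b+1
  ... | inj₁ x<b = m<n⇒m<o⊔n (suc (g b)) (below x x<b)
  ... | inj₂ refl = m<n⇒m<n⊔o c ≤-refl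

unbounded⇒escaping : ExcludedMiddle 0ℓ → (A : ℕ → Set) (g : ℕ → ℕ) →
  ¬ (Σ ℕ λ i → ∀ x → A x → g x < i) →
  ∀ t b → Σ ℕ λ x → (A x × t ≤ g x) × b ≤ x
unbounded⇒escaping em A g unbounded t b with em
... | yes escaping = escaping
... | no  stuck    = ⊥-elim (unbounded (t ⊔ c , bound))
  where
  c = proj₁ (bounded-on-initial-segment g b)
  below-c = proj₂ (bounded-on-initial-segment g b)

  bound : ∀ x → A x → g x < t ⊔ c
  bound x Ax with t ≤? g x | b ≤? x
  ... | no  t≰gx | _       = m<n⇒m<n⊔o c (≰⇒> t≰gx)
  ... | yes t≤gx | yes b≤x = ⊥-elim (stuck (x , (Ax , t≤gx) , b≤x))
  ... | yes _    | no  b≰x = m<n⇒m<o⊔n t (below-c x (≰⇒> b≰x))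

-- K_j is the run of J-blocks from the one after x_{j-1} up to that of x_j.
group-blocks : (J : IntervalPartition) (Q : ℕ → ℕ → Set) →
  (∀ j b → Σ ℕ λ x → Q j x × b ≤ x) →
  Σ IntervalPartition λ K →
    ∀ j → Σ ℕ λ x → Q j x × Σ ℕ λ k → InBlock x J k × InBlock k K j
group-blocks J Q escape =
  K , λ j → point j , proj₁ (chosen j) , index j , placed j , boundary≤index j , n<1+n (index j)
  where
  boundary : ℕ → ℕ
  point    : ℕ → ℕ
  chosen   : ∀ j → Q j (point j) × pt J (boundary j) ≤ point j
  index    : ℕ → ℕ

  boundary zero    = 0
  boundary (suc j) = suc (index j)
  point j  = proj₁ (escape j (pt J (boundary j)))
  chosen j = proj₂ (escape j (pt J (boundary j)))
  index j  = proj₁ (block-of J (point j))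

  placed : ∀ j → InBlock (point j) J (index j)
  placed j = proj₂ (block-of J (point j))

  boundary≤index : ∀ j → boundary j ≤ index j
  boundary≤index j = pt≤⇒≤-block J (proj₂ (chosen j)) (placed j)

  K : IntervalPartition
  K = record { pt = boundary ; pt0 = refl ; incr = λ j → s≤s (boundary≤index j) }

lemma2p9 : ExcludedMiddle 0ℓ → (S : Setup) → (J : D S) → (α : Ω S) →
    (A : ℕ → Set) →
    (∀ (I : D S) → Finite (λ x → A x × InZ S I J α x)) →
    Σ ℕ λ i → ∀ x → A x → f S J α x < i
lemma2p9 em S J α A finite with em
... | yes bounded = bounded
... | no  unbounded
  with group-blocks (part S J) (λ j x → A x × j ≤ f S J α x)
                    (unbounded⇒escaping em A (f S J α) unbounded)
... | K , hit with dominating S K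
... | I , N , catches with finite I
... | M , finite-I with catches (N + M) (m≤m+n N M)
... | j , n<j , K_j⊂I_n with hit j
... | x , (x∈A , j≤fx) , k , x∈J_k , k∈K_j = ⊥-elim (<⇒≱ x<M M≤x)
  where
  k∈I_n : InBlock k (part S I) (N + M)
  k∈I_n = InBlock-BlockSub K (part S I) K_j⊂I_n k∈K_j

  x<M : x < M
  x<M = finite-I x (x∈A , N + M , k , k∈I_n , x∈J_k , ≤-trans (<⇒≤ n<j) j≤fx)

  M≤x : M ≤ x
  M≤x = ≤-trans (m≤n+m M N)
          (≤-trans (InBlock⇒≤ (part S I) k∈I_n) (InBlock⇒≤ (part S J) x∈J_k))
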